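{- (Normalisation of a sum.) If the proof-terms $t$ and $u$ are strongly normalising for ultra-reduction, then so is $t\boxplus u$.
   Context: Let $\mathcal S$ be a semiring. Propositions: $A ::= X \mid \mathbf 1 \mid A\multimap A\mid A\otimes A\mid \top\mid \mathbf 0\mid A\,\&\,A\mid A\oplus A\mid\, !A\mid \forall X.A$. Proof-terms (modulo $\alpha$; $a\in\mathcal S$): $t ::= x \mid t\boxplus u\mid a\bullet t\mid a.\star\mid \delta_{\mathbf 1}(t,u)\mid \lambda x^A.t\mid t\,u\mid t\otimes u\mid \delta_\otimes(t,x^Ay^B.u)\mid\langle\rangle\mid \delta_{\mathbf 0}(t) \mid \langle t,u\rangle\mid \delta^1_\&(t,x^A.u)\mid\delta^2_\&(t,x^B.u)\mid \mathrm{inl}(t)\mid\mathrm{inr}(t)\mid\delta_\oplus(t,x^A.u,y^B.v)\mid\, !t\mid\delta_!(t,x^A.u)\mid\Lambda X.t\mid t\,A$ ($\boxplus$: proof-term sum). Ultra-reduction $\to$ is the closure under all proof-term contexts of: $\delta_{\mathbf 1}(a.\star,t)\to a\bullet t$; $(\lambda x^A.t)\,u\to(u/x)t$; $\delta_\otimes(u\otimes v,x^Ay^B.w)\to(u/x,v/y)w$; $\delta^i_\&(\langle t_1,t_2\rangle,x.v)\to(t_i/x)v$; $\delta_\oplus(\mathrm{inl}(t),x^A.v,y^B.w)\to(t/x)v$; $\delta_\oplus(\mathrm{inr}(u),x^A.v,y^B.w)\to(u/y)w$; $\delta_!(!t,x^A.u)\to(t/x)u$; $(\Lambda X.t)\,A\to(A/X)t$;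 $a.\star\boxplus b.\star\to(a+b).\star$; $(\lambda x^A.t)\boxplus(\lambda x^A.u)\to\lambda x^A.(t\boxplus u)$; $\delta_\otimes(t\boxplus u,x^Ay^B.v)\to\delta_\otimes(t,x^Ay^B.v)\boxplus\delta_\otimes(u,x^Ay^B.v)$; $\langle\rangle\boxplus\langle\rangle\to\langle\rangle$; $\langle t,u\rangle\boxplus\langle v,w\rangle\to\langle t\boxplus v,u\boxplus w\rangle$; $\delta_\oplus(t\boxplus u,x^A.v,y^B.w)\to\delta_\oplus(t,x^A.v,y^B.w)\boxplus\delta_\oplus(u,x^A.v,y^B.w)$; $!t\boxplus !u\to !(t\boxplus u)$; $(\Lambda X.t)\boxplus(\Lambda X.u)\to\Lambda X.(t\boxplus u)$; $a\bullet b.\star\to(a\times b).\star$; $a\bullet\lambda x^A.t\to\lambda x^A.a\bullet t$; $\delta_\otimes(a\bullet t,x^Ay^B.v)\to a\bullet\delta_\otimes(t,x^Ay^B.v)$; $a\bullet\langle\rangle\to\langle\rangle$; $a\bullet\langle t,u\rangle\to\langle a\bullet t,a\bullet u\rangle$; $\delta_\oplus(a\bullet t,x^A.v,y^B.w)\to a\bullet\delta_\oplus(t,x^A.v,y^B.w)$; $a\bullet !t\to !(a\bullet t)$; $a\bullet\Lambda X.t\to\Lambda X.a\bullet t$; $t\boxplus u\to t$; $t\boxplus u\to u$; $a\bullet t\to t$. -}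

module Defs where

open import Level using (Level)
open import Data.Nat using (ℕ; zero; suc)
open import Algebra.Bundles using (Semiring)
open import Induction.WellFounded using (Acc)

-- Propositions, with type variables as (unscoped) de Bruijn indices.
data Ty : Set where
  tvar : ℕ → Ty
  𝟏    : Ty
  _⊸_  : Ty → Ty → Ty
  _⊗ᵀ_ : Ty → Ty → Ty
  ⊤ᵀ   : Ty
  𝟎    : Ty
  _&_  : Ty → Ty → Ty
  _⊕_  : Ty → Ty → Ty
  !ᵀ_  : Ty → Ty
  ∀ᵀ   : Ty → Ty          -- ∀X.A, X bound as type index 0

liftᵣ : (ℕ → ℕ) → ℕ → ℕ
liftᵣ ρ zero    = zero
liftᵣ ρ (suc i) = suc (ρ i)

tyRen : (ℕ → ℕ) → Ty → Ty
tyRen ρ (tvar i) = tvar (ρ i)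
tyRen ρ 𝟏 = 𝟏
tyRen ρ (A ⊸ B) = tyRen ρ A ⊸ tyRen ρ B
tyRen ρ (A ⊗ᵀ B) = tyRen ρ A ⊗ᵀ tyRen ρ B
tyRen ρ ⊤ᵀ = ⊤ᵀ
tyRen ρ 𝟎 = 𝟎
tyRen ρ (A & B) = tyRen ρ A & tyRen ρ B
tyRen ρ (A ⊕ B) = tyRen ρ A ⊕ tyRen ρ B
tyRen ρ (!ᵀ A) = !ᵀ tyRen ρ A
tyRen ρ (∀ᵀ A) = ∀ᵀ (tyRen (liftᵣ ρ) A)

liftₜ : (ℕ → Ty) → ℕ → Ty
liftₜ τ zero    = tvar zero
liftₜ τ (suc i) = tyRen suc (τ i)

tySub : (ℕ → Ty) → Ty → Ty
tySub τ (tvar i) = τ i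
tySub τ 𝟏 = 𝟏
tySub τ (A ⊸ B) = tySub τ A ⊸ tySub τ B
tySub τ (A ⊗ᵀ B) = tySub τ A ⊗ᵀ tySub τ B
tySub τ ⊤ᵀ = ⊤ᵀ
tySub τ 𝟎 = 𝟎
tySub τ (A & B) = tySub τ A & tySub τ B
tySub τ (A ⊕ B) = tySub τ A ⊕ tySub τ B
tySub τ (!ᵀ A) = !ᵀ tySub τ A
tySub τ (∀ᵀ A) = ∀ᵀ (tySub (liftₜ τ) A)

-- Proof-terms over a semiring 𝒮 (modulo α: de Bruijn indices, separate
-- namespaces for term variables and type variables).
module Syntax {c ℓ : Level} (𝒮 : Semiring c ℓ) where

  open Semiring 𝒮 using () renaming (Carrier to S; _+_ to _+ₛ_; _*_ to _*ₛ_)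

  infixl 5 _⊞_
  infixr 6 _•_

  data Tm : Set c where
    var  : ℕ → Tm
    _⊞_  : Tm → Tm → Tm
    _•_  : S → Tm → Tm
    star : S → Tm
    δ𝟏   : Tm → Tm → Tm
    lam  : Ty → Tm → Tm                 -- λx^A.t   (x = index 0)
    app  : Tm → Tm → Tm
    _⊗ₜ_ : Tm → Tm → Tm
    δ⊗   : Tm → Ty → Ty → Tm → Tm       -- δ_⊗(t, x^A y^B. u)  (x = 1, y = 0)
    unit : Tm
    δ𝟎   : Tm → Tm
    pair : Tm → Tm → Tm
    δ&₁  : Tm → Ty → Tm → Tm
    δ&₂  : Tm → Ty → Tm → Tm
    inl  : Tm → Tm
    inr  : Tm → Tm
    δ⊕   : Tm → Ty → Tm → Ty → Tm → Tm
    bang : Tm → Tm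
    δ!   : Tm → Ty → Tm → Tm
    Λ    : Tm → Tm                      -- ΛX.t  (X = type index 0)
    tapp : Tm → Ty → Tm

  tmTySub : (ℕ → Ty) → Tm → Tm
  tmTySub τ (var i) = var i
  tmTySub τ (t ⊞ u) = tmTySub τ t ⊞ tmTySub τ u
  tmTySub τ (a • t) = a • tmTySub τ t
  tmTySub τ (star a) = star a
  tmTySub τ (δ𝟏 t u) = δ𝟏 (tmTySub τ t) (tmTySub τ u)
  tmTySub τ (lam A t) = lam (tySub τ A) (tmTySub τ t)
  tmTySub τ (app t u) = app (tmTySub τ t) (tmTySub τ u)
  tmTySub τ (t ⊗ₜ u) = tmTySub τ t ⊗ₜ tmTySub τ u
  tmTySub τ (δ⊗ t A B u) = δ⊗ (tmTySub τ t) (tySub τ A) (tySub τ B) (tmTySub τ u)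
  tmTySub τ unit = unit
  tmTySub τ (δ𝟎 t) = δ𝟎 (tmTySub τ t)
  tmTySub τ (pair t u) = pair (tmTySub τ t) (tmTySub τ u)
  tmTySub τ (δ&₁ t A u) = δ&₁ (tmTySub τ t) (tySub τ A) (tmTySub τ u)
  tmTySub τ (δ&₂ t A u) = δ&₂ (tmTySub τ t) (tySub τ A) (tmTySub τ u)
  tmTySub τ (inl t) = inl (tmTySub τ t)
  tmTySub τ (inr t) = inr (tmTySub τ t)
  tmTySub τ (δ⊕ t A v B w) = δ⊕ (tmTySub τ t) (tySub τ A) (tmTySub τ v) (tySub τ B) (tmTySub τ w)
  tmTySub τ (bang t) = bang (tmTySub τ t)
  tmTySub τ (δ! t A u) = δ! (tmTySub τ t) (tySub τ A) (tmTySub τ u)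
  tmTySub τ (Λ t) = Λ (tmTySub (liftₜ τ) t)
  tmTySub τ (tapp t A) = tapp (tmTySub τ t) (tySub τ A)

  tmRen : (ℕ → ℕ) → Tm → Tm
  tmRen ρ (var i) = var (ρ i)
  tmRen ρ (t ⊞ u) = tmRen ρ t ⊞ tmRen ρ u
  tmRen ρ (a • t) = a • tmRen ρ t
  tmRen ρ (star a) = star a
  tmRen ρ (δ𝟏 t u) = δ𝟏 (tmRen ρ t) (tmRen ρ u)
  tmRen ρ (lam A t) = lam A (tmRen (liftᵣ ρ) t)
  tmRen ρ (app t u) = app (tmRen ρ t) (tmRen ρ u)
  tmRen ρ (t ⊗ₜ u) = tmRen ρ t ⊗ₜ tmRen ρ u
  tmRen ρ (δ⊗ t A B u) = δ⊗ (tmRen ρ t) A B (tmRen (liftᵣ (liftᵣ ρ)) u)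
  tmRen ρ unit = unit
  tmRen ρ (δ𝟎 t) = δ𝟎 (tmRen ρ t)
  tmRen ρ (pair t u) = pair (tmRen ρ t) (tmRen ρ u)
  tmRen ρ (δ&₁ t A u) = δ&₁ (tmRen ρ t) A (tmRen (liftᵣ ρ) u)
  tmRen ρ (δ&₂ t A u) = δ&₂ (tmRen ρ t) A (tmRen (liftᵣ ρ) u)
  tmRen ρ (inl t) = inl (tmRen ρ t)
  tmRen ρ (inr t) = inr (tmRen ρ t)
  tmRen ρ (δ⊕ t A v B w) = δ⊕ (tmRen ρ t) A (tmRen (liftᵣ ρ) v) B (tmRen (liftᵣ ρ) w)
  tmRen ρ (bang t) = bang (tmRen ρ t)
  tmRen ρ (δ! t A u) = δ! (tmRen ρ t) A (tmRen (liftᵣ ρ) u)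
  tmRen ρ (Λ t) = Λ (tmRen ρ t)
  tmRen ρ (tapp t A) = tapp (tmRen ρ t) A

  exts : (ℕ → Tm) → ℕ → Tm
  exts σ zero    = var zero
  exts σ (suc i) = tmRen suc (σ i)

  extsᵀ : (ℕ → Tm) → ℕ → Tm
  extsᵀ σ i = tmTySub (λ j → tvar (suc j)) (σ i)

  tmSub : (ℕ → Tm) → Tm → Tm
  tmSub σ (var i) = σ i
  tmSub σ (t ⊞ u) = tmSub σ t ⊞ tmSub σ u
  tmSub σ (a • t) = a • tmSub σ t
  tmSub σ (star a) = star a
  tmSub σ (δ𝟏 t u) = δ𝟏 (tmSub σ t) (tmSub σ u)
  tmSub σ (lam A t) = lam A (tmSub (exts σ) t)
  tmSub σ (app t u) = app (tmSub σ t) (tmSub σ u)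
  tmSub σ (t ⊗ₜ u) = tmSub σ t ⊗ₜ tmSub σ u
  tmSub σ (δ⊗ t A B u) = δ⊗ (tmSub σ t) A B (tmSub (exts (exts σ)) u)
  tmSub σ unit = unit
  tmSub σ (δ𝟎 t) = δ𝟎 (tmSub σ t)
  tmSub σ (pair t u) = pair (tmSub σ t) (tmSub σ u)
  tmSub σ (δ&₁ t A u) = δ&₁ (tmSub σ t) A (tmSub (exts σ) u)
  tmSub σ (δ&₂ t A u) = δ&₂ (tmSub σ t) A (tmSub (exts σ) u)
  tmSub σ (inl t) = inl (tmSub σ t)
  tmSub σ (inr t) = inr (tmSub σ t)
  tmSub σ (δ⊕ t A v B w) = δ⊕ (tmSub σ t) A (tmSub (exts σ) v) B (tmSub (exts σ) w)
  tmSub σ (bang t) = bang (tmSub σ t)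
  tmSub σ (δ! t A u) = δ! (tmSub σ t) A (tmSub (exts σ) u)
  tmSub σ (Λ t) = Λ (tmSub (extsᵀ σ) t)
  tmSub σ (tapp t A) = tapp (tmSub σ t) A

  _[_] : Tm → Tm → Tm
  t [ u ] = tmSub σ t
    where
    σ : ℕ → Tm
    σ zero    = u
    σ (suc i) = var i

  -- (u/x, v/y)w  where x is index 1 and y is index 0
  _[_,_]₂ : Tm → Tm → Tm → Tm
  w [ u , v ]₂ = tmSub σ w
    where
    σ : ℕ → Tm
    σ zero          = v
    σ (suc zero)    = u
    σ (suc (suc i)) = var i

  _[_]ᵀ : Tm → Ty → Tm
  t [ A ]ᵀ = tmTySub τ t
    where
    τ : ℕ → Ty
    τ zero    = A
    τ (suc i) = tvar i

  infix 4 _↦_ _⟶_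

  data _↦_ : Tm → Tm → Set c where
    β𝟏   : ∀ {a t} → δ𝟏 (star a) t ↦ a • t
    β⊸   : ∀ {A t u} → app (lam A t) u ↦ t [ u ]
    β⊗   : ∀ {u v A B w} → δ⊗ (u ⊗ₜ v) A B w ↦ w [ u , v ]₂
    β&₁  : ∀ {t₁ t₂ A v} → δ&₁ (pair t₁ t₂) A v ↦ v [ t₁ ]
    β&₂  : ∀ {t₁ t₂ A v} → δ&₂ (pair t₁ t₂) A v ↦ v [ t₂ ]
    β⊕₁  : ∀ {t A v B w} → δ⊕ (inl t) A v B w ↦ v [ t ]
    β⊕₂  : ∀ {u A v B w} → δ⊕ (inr u) A v B w ↦ w [ u ]
    β!   : ∀ {t A u} → δ! (bang t) A u ↦ u [ t ]
    β∀   : ∀ {t A} → tapp (Λ t) A ↦ t [ A ]ᵀ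
    ⊞⋆   : ∀ {a b} → star a ⊞ star b ↦ star (a +ₛ b)
    ⊞λ   : ∀ {A t u} → lam A t ⊞ lam A u ↦ lam A (t ⊞ u)
    ⊞δ⊗  : ∀ {t u A B v} → δ⊗ (t ⊞ u) A B v ↦ δ⊗ t A B v ⊞ δ⊗ u A B v
    ⊞⟨⟩  : unit ⊞ unit ↦ unit
    ⊞pr  : ∀ {t u v w} → pair t u ⊞ pair v w ↦ pair (t ⊞ v) (u ⊞ w)
    ⊞δ⊕  : ∀ {t u A v B w} → δ⊕ (t ⊞ u) A v B w ↦ δ⊕ t A v B w ⊞ δ⊕ u A v B w
    ⊞!   : ∀ {t u} → bang t ⊞ bang u ↦ bang (t ⊞ u)
    ⊞Λ   : ∀ {t u} → Λ t ⊞ Λ u ↦ Λ (t ⊞ u)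
    •⋆   : ∀ {a b} → a • star b ↦ star (a *ₛ b)
    •λ   : ∀ {a A t} → a • lam A t ↦ lam A (a • t)
    •δ⊗  : ∀ {a t A B v} → δ⊗ (a • t) A B v ↦ a • δ⊗ t A B v
    •⟨⟩  : ∀ {a} → a • unit ↦ unit
    •pr  : ∀ {a t u} → a • pair t u ↦ pair (a • t) (a • u)
    •δ⊕  : ∀ {a t A v B w} → δ⊕ (a • t) A v B w ↦ a • δ⊕ t A v B w
    •!   : ∀ {a t} → a • bang t ↦ bang (a • t)
    •Λ   : ∀ {a t} → a • Λ t ↦ Λ (a • t)
    ⊞ₗ   : ∀ {t u} → t ⊞ u ↦ t
    ⊞ᵣ   : ∀ {t u} → t ⊞ u ↦ u
    •ε   : ∀ {a t} → a • t ↦ t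

  data _⟶_ : Tm → Tm → Set c where
    root  : ∀ {t t'} → t ↦ t' → t ⟶ t'
    ⊞₁    : ∀ {t t' u} → t ⟶ t' → t ⊞ u ⟶ t' ⊞ u
    ⊞₂    : ∀ {t u u'} → u ⟶ u' → t ⊞ u ⟶ t ⊞ u'
    •₁    : ∀ {a t t'} → t ⟶ t' → a • t ⟶ a • t'
    δ𝟏₁   : ∀ {t t' u} → t ⟶ t' → δ𝟏 t u ⟶ δ𝟏 t' u
    δ𝟏₂   : ∀ {t u u'} → u ⟶ u' → δ𝟏 t u ⟶ δ𝟏 t u'
    lam₁  : ∀ {A t t'} → t ⟶ t' → lam A t ⟶ lam A t'
    app₁  : ∀ {t t' u} → t ⟶ t' → app t u ⟶ app t' u
    app₂  : ∀ {t u u'} → u ⟶ u' → app t u ⟶ app t u'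
    ⊗₁    : ∀ {t t' u} → t ⟶ t' → t ⊗ₜ u ⟶ t' ⊗ₜ u
    ⊗₂    : ∀ {t u u'} → u ⟶ u' → t ⊗ₜ u ⟶ t ⊗ₜ u'
    δ⊗₁   : ∀ {t t' A B u} → t ⟶ t' → δ⊗ t A B u ⟶ δ⊗ t' A B u
    δ⊗₂   : ∀ {t A B u u'} → u ⟶ u' → δ⊗ t A B u ⟶ δ⊗ t A B u'
    δ𝟎₁   : ∀ {t t'} → t ⟶ t' → δ𝟎 t ⟶ δ𝟎 t'
    pair₁ : ∀ {t t' u} → t ⟶ t' → pair t u ⟶ pair t' u
    pair₂ : ∀ {t u u'} → u ⟶ u' → pair t u ⟶ pair t u'
    δ&₁₁  : ∀ {t t' A u} → t ⟶ t' → δ&₁ t A u ⟶ δ&₁ t' A u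
    δ&₁₂  : ∀ {t A u u'} → u ⟶ u' → δ&₁ t A u ⟶ δ&₁ t A u'
    δ&₂₁  : ∀ {t t' A u} → t ⟶ t' → δ&₂ t A u ⟶ δ&₂ t' A u
    δ&₂₂  : ∀ {t A u u'} → u ⟶ u' → δ&₂ t A u ⟶ δ&₂ t A u'
    inl₁  : ∀ {t t'} → t ⟶ t' → inl t ⟶ inl t'
    inr₁  : ∀ {t t'} → t ⟶ t' → inr t ⟶ inr t'
    δ⊕₁   : ∀ {t t' A v B w} → t ⟶ t' → δ⊕ t A v B w ⟶ δ⊕ t' A v B w
    δ⊕₂   : ∀ {t A v v' B w} → v ⟶ v' → δ⊕ t A v B w ⟶ δ⊕ t A v' B w
    δ⊕₃   : ∀ {t A v B w w'} → w ⟶ w' → δ⊕ t A v B w ⟶ δ⊕ t A v B w'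
    bang₁ : ∀ {t t'} → t ⟶ t' → bang t ⟶ bang t'
    δ!₁   : ∀ {t t' A u} → t ⟶ t' → δ! t A u ⟶ δ! t' A u
    δ!₂   : ∀ {t A u u'} → u ⟶ u' → δ! t A u ⟶ δ! t A u'
    Λ₁    : ∀ {t t'} → t ⟶ t' → Λ t ⟶ Λ t'
    tapp₁ : ∀ {t t' A} → t ⟶ t' → tapp t A ⟶ tapp t' A

  SN : Tm → Set c
  SN = Acc (λ u t → t ⟶ u)

{-# OPTIONS --safe #-}
module Submission where

-- Induction on the pair (t, u), ordered by reduction together with the
-- immediate-subterm relation of λ, ⟨_,_⟩, ! and Λ: a reduction of t ⊞ u either
-- reduces t or u, projects onto t or u, or pushes ⊞ under one of these
-- constructors, producing sums of immediate subterms. This order is well founded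
-- below SN terms because a reduction of a subterm lifts to the whole term, so it
-- can be postponed past the subterm steps.

open import Defs
open import Algebra.Bundles using (Semiring)
open import Level using (Level)
open import Data.Product using (∃; _×_; _,_)
open import Data.Sum using (inj₁; inj₂)
open import Function using (flip)
open import Relation.Binary.Core using (Rel)
open import Relation.Binary.Construct.Union using (_∪_)
open import Relation.Binary.Construct.Closure.ReflexiveTransitive using (Star; ε; _◅_)
open import Induction.WellFounded using (Acc; acc; WellFounded; module Subrelation)

module _ {a ℓ₁ ℓ₂} {A : Set a} {_<₁_ : Rel A ℓ₁} {_<₂_ : Rel A ℓ₂}
         (<₂-wellFounded : WellFounded _<₂_)
         (postpone : ∀ {x y z} → x <₁ y → y <₂ z → ∃ λ w → x <₂ w × w <₁ z)
         where

  postpone⋆ : ∀ {x y z} → x <₁ y → Star _<₂_ y z → ∃ λ w → Star _<₂_ x w × w <₁ z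
  postpone⋆ x<y ε = _ , ε , x<y
  postpone⋆ x<y (y<v ◅ v≤z) with postpone x<y y<v
  ... | w , x<w , w<v with postpone⋆ w<v v≤z
  ... | w' , w≤w' , w'<z = w' , x<w ◅ w≤w' , w'<z

  private
    acc-∪-below : ∀ {y z} → Acc _<₁_ z → Acc _<₂_ y → Star _<₂_ y z → Acc (_<₁_ ∪ _<₂_) y
    acc-∪-below-rec : ∀ {x y z} → Acc _<₁_ z → Acc _<₂_ y → Star _<₂_ y z →
                      (_<₁_ ∪ _<₂_) x y → Acc (_<₁_ ∪ _<₂_) x

    acc-∪-below acc₁ acc₂ y≤z = acc (acc-∪-below-rec acc₁ acc₂ y≤z)

    acc-∪-below-rec (acc rec₁) _ y≤z (inj₁ x<y) with postpone⋆ x<y y≤z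
    ... | w , x≤w , w<z = acc-∪-below (rec₁ w<z) (<₂-wellFounded _) x≤w
    acc-∪-below-rec acc₁ (acc rec₂) y≤z (inj₂ x<y) = acc-∪-below acc₁ (rec₂ x<y) (x<y ◅ y≤z)

  acc-∪ : ∀ {x} → Acc _<₁_ x → Acc (_<₁_ ∪ _<₂_) x
  acc-∪ {x} acc₁ = acc-∪-below acc₁ (<₂-wellFounded x) ε

module _ {c ℓ : Level} (𝒮 : Semiring c ℓ) where
  open Syntax 𝒮

  infix 4 _◁_

  data _◁_ : Tm → Tm → Set c where
    lam◁   : ∀ {A s} → s ◁ lam A s
    pair◁₁ : ∀ {s w} → s ◁ pair s w
    pair◁₂ : ∀ {s w} → s ◁ pair w s
    bang◁  : ∀ {s} → s ◁ bang s
    Λ◁     : ∀ {s} → s ◁ Λ s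

  ◁-wellFounded : WellFounded _◁_
  ◁-accessible : ∀ {s} t → s ◁ t → Acc _◁_ s

  ◁-wellFounded t = acc (◁-accessible t)

  ◁-accessible (lam A s) lam◁ = ◁-wellFounded s
  ◁-accessible (pair s w) pair◁₁ = ◁-wellFounded s
  ◁-accessible (pair w s) pair◁₂ = ◁-wellFounded s
  ◁-accessible (bang s) bang◁ = ◁-wellFounded s
  ◁-accessible (Λ s) Λ◁ = ◁-wellFounded s

  ⟶-lift-◁ : ∀ {s s' t} → s ⟶ s' → s ◁ t → ∃ λ t' → s' ◁ t' × t ⟶ t'
  ⟶-lift-◁ r lam◁ = _ , lam◁ , lam₁ r
  ⟶-lift-◁ r pair◁₁ = _ , pair◁₁ , pair₁ r
  ⟶-lift-◁ r pair◁₂ = _ , pair◁₂ , pair₂ r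
  ⟶-lift-◁ r bang◁ = _ , bang◁ , bang₁ r
  ⟶-lift-◁ r Λ◁ = _ , Λ◁ , Λ₁ r

  _≺_ : Rel Tm c
  _≺_ = flip _⟶_ ∪ _◁_

  SN⇒Acc≺ : ∀ {t} → SN t → Acc _≺_ t
  SN⇒Acc≺ = acc-∪ ◁-wellFounded ⟶-lift-◁

  Acc≺⇒SN : ∀ {t} → Acc _≺_ t → SN t
  Acc≺⇒SN = Subrelation.accessible inj₁

  SN-star : ∀ {a} → SN (star a)
  SN-star = acc λ where (root ())

  SN-unit : SN unit
  SN-unit = acc λ where (root ())

  SN-lam : ∀ {A t} → SN t → SN (lam A t)
  SN-lam (acc rec) = acc λ where
    (lam₁ r) → SN-lam (rec r)
    (root ())

  SN-pair : ∀ {t u} → SN t → SN u → SN (pair t u)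
  SN-pair (acc rec₁) (acc rec₂) = acc λ where
    (pair₁ r) → SN-pair (rec₁ r) (acc rec₂)
    (pair₂ r) → SN-pair (acc rec₁) (rec₂ r)
    (root ())

  SN-bang : ∀ {t} → SN t → SN (bang t)
  SN-bang (acc rec) = acc λ where
    (bang₁ r) → SN-bang (rec r)
    (root ())

  SN-Λ : ∀ {t} → SN t → SN (Λ t)
  SN-Λ (acc rec) = acc λ where
    (Λ₁ r) → SN-Λ (rec r)
    (root ())

  Acc≺-⊞⇒SN : ∀ {t u} → Acc _≺_ t → Acc _≺_ u → SN (t ⊞ u)
  Acc≺-⊞⇒SN {t} {u} at@(acc rec₁) au@(acc rec₂) = acc reduct-SN
    where
    sum-below : ∀ {t' u'} → t' ◁ t → u' ◁ u → SN (t' ⊞ u')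
    sum-below t'◁t u'◁u = Acc≺-⊞⇒SN (rec₁ (inj₂ t'◁t)) (rec₂ (inj₂ u'◁u))

    reduct-SN : ∀ {v} → t ⊞ u ⟶ v → SN v
    reduct-SN (⊞₁ r) = Acc≺-⊞⇒SN (rec₁ (inj₁ r)) au
    reduct-SN (⊞₂ r) = Acc≺-⊞⇒SN at (rec₂ (inj₁ r))
    reduct-SN (root ⊞ₗ) = Acc≺⇒SN at
    reduct-SN (root ⊞ᵣ) = Acc≺⇒SN au
    reduct-SN (root ⊞⋆) = SN-star
    reduct-SN (root ⊞⟨⟩) = SN-unit
    reduct-SN (root ⊞λ) = SN-lam (sum-below lam◁ lam◁)
    reduct-SN (root ⊞pr) = SN-pair (sum-below pair◁₁ pair◁₁) (sum-below pair◁₂ pair◁₂)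
    reduct-SN (root ⊞!) = SN-bang (sum-below bang◁ bang◁)
    reduct-SN (root ⊞Λ) = SN-Λ (sum-below Λ◁ Λ◁)

lemma8 : ∀ {c ℓ} (𝒮 : Semiring c ℓ) → let open Syntax 𝒮 in
           (t u : Tm) → SN t → SN u → SN (t ⊞ u)
lemma8 𝒮 t u sn-t sn-u = Acc≺-⊞⇒SN 𝒮 (SN⇒Acc≺ 𝒮 sn-t) (SN⇒Acc≺ 𝒮 sn-u)
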